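{- Let $I_{age}$ be an instance of the Min-Age problem and $I_{job}$ its corresponding Min-WCS instance, and let $S^*_{age}$ and $S^*_{job}$ be optimal schedules of $I_{age}$ and $I_{job}$, respectively. Then $2\,Age(S^*_{age}) = wcs(S^*_{job})$.
   Context: Min-Age problem. Input: a positive integer $n$, an integer $T_0 \geq 0$, and for each $i$ a positive integer $m_i$ and messages $M_i^0, \dots, M_i^{m_i}$ with integer birthdays with $0 \leq b(M_i^0) < b(M_i^1) < \cdots < b(M_i^{m_i}) \leq T_0$. Let $\mathcal{M}_i = \{M_i^1,\dots,M_i^{m_i}\}$ and $T = \sum_i m_i$. A feasible schedule $S$ is a bijection from $\bigcup_i\mathcal{M}_i$ to $\{T_0+1,\dots,T_0+T\}$ with $S(M_i^1) < \cdots < S(M_i^{m_i})$ for every $i$. For an integer $t$, $lm(S,i,t)$ is $M_i^j$ with $j$ the largest index in $\{0,\dots,m_i\}$ with $j=0$ or $S(M_i^j)\leq t$; $age(S,i,t) = t - b(lm(S,i,t))$ if $lm(S,i,t) \neq M_i^{m_i}$ and $0$ otherwise; $Age(S) = \sum_{i=1}^n \sum_{t=T_0}^{T_0+T} age(S,i,t)$; an optimal schedule minimizes $Age$ over feasible schedules. Min-WCS problem. Input: job chains $\mathcal{C}_1,\dots,\mathcal{C}_n$, $\mathcal{C}_i$ consisting of jobs $J_i^1 \to \cdots \to J_i^{|\mathcal{C}_i|}$ with non-negative weights $w_i^j$; with $T=\sum_i|\mathcal{C}_i|$, a feasible schedule $S$ is a bijection from all jobs to $\{1,\dots,T\}$ with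 $S(J_i^1)<\cdots<S(J_i^{|\mathcal{C}_i|})$ for all $i$; $wcs(S)=\sum_{i,j} w_i^j S(J_i^j)+\sum_{i} S(J_i^{|\mathcal{C}_i|})^2$; an optimal schedule minimizes $wcs$. Corresponding instance: given $I_{age}$, $I_{job}$ has $n$ chains with $|\mathcal{C}_i| = m_i$, weights $w_i^j = 2(b(M_i^j) - b(M_i^{j-1}))$ for $1\leq j\leq |\mathcal{C}_i|-1$, and $w_i^{|\mathcal{C}_i|} = 2(T_0 - \tfrac12 - b(M_i^{m_i-1}))$. -}

module Defs where

open import Data.Nat using (ℕ; zero; suc; _+_; _*_; _∸_; _≤_; _<_; _≤ᵇ_)
open import Data.Fin as F using (Fin; toℕ; fromℕ; inject₁)
open import Data.Bool using (Bool; true; false; if_then_else_)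
open import Data.List using (List; map; allFin; upTo)
open import Data.Nat.ListAction using (sum)
open import Data.Product using (Σ; _,_)
open import Function.Bundles using (_⤖_; Bijection)
open import Relation.Nullary using (does)

∑Fin : (n : ℕ) → (Fin n → ℕ) → ℕ
∑Fin n f = sum (map f (allFin n))

-- sum_{t = a}^{a + k} f t   (k+1 terms)
∑Range : (a k : ℕ) → (ℕ → ℕ) → ℕ
∑Range a k f = sum (map (λ s → f (a + s)) (upTo (suc k)))

-- largest j ∈ {0..k} with j = 0 or p (j-1) holds
-- (p indexes the elements 1..k as Fin k, element j+1 ↦ index j)
largestIdx : (k : ℕ) → (Fin k → Bool) → Fin (suc k)
largestIdx zero p = F.zero
largestIdx (suc k) p =
  if p (fromℕ k) then fromℕ (suc k) else inject₁ (largestIdx k (λ j → p (inject₁ j)))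

record AgeInstance : Set where
  field
    n      : ℕ
    n-pos  : 0 < n
    T₀     : ℕ
    m      : Fin n → ℕ
    m-pos  : ∀ i → 0 < m i
    -- b i j = b(M_i^j), j ∈ {0..m_i}
    b      : (i : Fin n) → Fin (suc (m i)) → ℕ
    b-inc  : ∀ i (j k : Fin (suc (m i))) → j F.< k → b i j < b i k
    b-le   : ∀ i → b i (fromℕ (m i)) ≤ T₀

module _ (I : AgeInstance) where
  open AgeInstance I

  Ttot : ℕ
  Ttot = ∑Fin n m

  -- (i , j) represents the message M_i^{j+1} ∈ 𝓜_i
  Msg : Set
  Msg = Σ (Fin n) (λ i → Fin (m i))

  -- feasible schedule: bijection 𝓜 → {T₀+1,…,T₀+T} (slot k ∈ Fin T is time T₀+1+k)
  record AgeSchedule : Set where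
    field
      slot  : Msg ⤖ Fin Ttot
      chain : ∀ i (j k : Fin (m i)) → j F.< k →
              Bijection.to slot (i , j) F.< Bijection.to slot (i , k)

    S : Msg → ℕ
    S x = T₀ + suc (toℕ (Bijection.to slot x))

    -- index of lm(S,i,t) among M_i^0,…,M_i^{m_i}
    lmIdx : (i : Fin n) → ℕ → Fin (suc (m i))
    lmIdx i t = largestIdx (m i) (λ j → S (i , j) ≤ᵇ t)

    age : Fin n → ℕ → ℕ
    age i t = if does (lmIdx i t F.≟ fromℕ (m i)) then 0 else t ∸ b i (lmIdx i t)

    Age : ℕ
    Age = ∑Fin n (λ i → ∑Range T₀ Ttot (λ t → age i t))

  AgeOptimal : AgeSchedule → Set
  AgeOptimal S = ∀ (S′ : AgeSchedule) → AgeSchedule.Age S ≤ AgeSchedule.Age S′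

lastOf : (k : ℕ) → 0 < k → Fin k
lastOf (suc k) _ = fromℕ k

record WCSInstance : Set where
  field
    n     : ℕ
    len   : Fin n → ℕ
    len-pos : ∀ i → 0 < len i
    -- w i j = weight of job J_i^{j+1}
    w     : (i : Fin n) → Fin (len i) → ℕ

module _ (J : WCSInstance) where
  open WCSInstance J

  Tjob : ℕ
  Tjob = ∑Fin n len

  Job : Set
  Job = Σ (Fin n) (λ i → Fin (len i))

  record JobSchedule : Set where
    field
      slot  : Job ⤖ Fin Tjob
      chain : ∀ i (j k : Fin (len i)) → j F.< k →
              Bijection.to slot (i , j) F.< Bijection.to slot (i , k)

    S : Job → ℕ
    S x = suc (toℕ (Bijection.to slot x))

    wcs : ℕ
    wcs = ∑Fin n (λ i → ∑Fin (len i) (λ j → w i j * S (i , j)))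
        + ∑Fin n (λ i → S (i , lastOf (len i) (len-pos i)) * S (i , lastOf (len i) (len-pos i)))

  WCSOptimal : JobSchedule → Set
  WCSOptimal S = ∀ (S′ : JobSchedule) → JobSchedule.wcs S ≤ JobSchedule.wcs S′

corresponding : AgeInstance → WCSInstance
corresponding I = record
  { n = n
  ; len = m
  ; len-pos = m-pos
  ; w = λ i j →
      if suc (toℕ j) Data.Nat.≡ᵇ m i
      then 2 * T₀ ∸ 1 ∸ 2 * b i (inject₁ j)        -- 2(T₀ − ½ − b(M_i^{m_i−1}))
      else 2 * (b i (F.suc j) ∸ b i (inject₁ j))
  }
  where open AgeInstance I

module Submission where

-- Feasible schedules of the two instances are the same data, a chain-respecting
-- bijection of messages onto slots, and for each of them 2·Age = wcs; so the two
-- optima coincide. Fix a chain with birthdays b(M⁰) < ⋯ < b(Mᵐ) ≤ T₀ and delivery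
-- times T₀ + s₁ < ⋯ < T₀ + sₘ. While u < sₘ the age at time T₀ + u is
-- u + (T₀ − b(Mᵐ)) plus the increments b(Mʲ) − b(Mʲ⁻¹) of the messages not yet
-- delivered (telescoping from the last delivered message up to Mᵐ), and it is 0
-- afterwards. Summing over u gives Σ_{u<sₘ} u + sₘ (T₀ − b(Mᵐ)) + Σⱼ sⱼ (b(Mʲ) − b(Mʲ⁻¹)).
-- Twice this is Σⱼ wⱼ sⱼ + sₘ², since wⱼ = 2 (b(Mʲ) − b(Mʲ⁻¹)) for j < m, while
-- wₘ = 2 (T₀ − b(Mᵐ⁻¹)) − 1 and 2 Σ_{u<s} u = s² − s.

open import Defs
open import Data.Nat using (ℕ; zero; suc; _+_; _*_; _∸_; _≤_; _<_; _≤ᵇ_; _≡ᵇ_; _≟_; s≤s)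
open import Data.Nat.Properties
open import Data.Nat.Tactic.RingSolver using (solve-∀)
open import Data.Nat.ListAction as List using ()
open import Data.Fin as F using (Fin; toℕ; fromℕ; inject₁)
open import Data.Fin.Properties using (toℕ-fromℕ; toℕ-inject₁; toℕ-inject₁-≢; fromℕ≢inject₁; toℕ-injective; toℕ<n; ≤fromℕ; ≤̄⇒inject₁<)
open import Data.Bool using (Bool; true; false; if_then_else_)
open import Data.Bool.Properties using (T-≡)
open import Data.List using (tabulate; applyUpTo)
open import Data.List.Properties using (map-tabulate; map-applyUpTo)
open import Data.Sum using (inj₁; inj₂)
open import Data.Product using (_,_)
open import Algebra.Properties.Semiring.Sum +-*-semiring using (sum-syntax; ∑-distrib-+; ∑-comm; sum-cong-≗; sum-init-last; sum-replicate-zero; *-distribˡ-sum)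
open import Function using (_∘_; id)
open import Function.Bundles using (Bijection; Equivalence)
open import Relation.Nullary using (¬_; does; yes; no)
open import Relation.Nullary.Decidable using (dec-true; dec-false)
open import Relation.Binary.PropositionalEquality
open ≡-Reasoning

sum-tabulate : ∀ {n} (f : Fin n → ℕ) → List.sum (tabulate f) ≡ ∑[ i < n ] f i
sum-tabulate {zero}  f = refl
sum-tabulate {suc n} f = cong (f F.zero +_) (sum-tabulate (f ∘ F.suc))

∑Fin≡∑ : ∀ n (f : Fin n → ℕ) → ∑Fin n f ≡ ∑[ i < n ] f i
∑Fin≡∑ n f = trans (cong List.sum (map-tabulate id f)) (sum-tabulate f)

sum-applyUpTo : ∀ n (f : ℕ → ℕ) → List.sum (applyUpTo f n) ≡ ∑[ u < n ] f (toℕ u)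
sum-applyUpTo zero    f = refl
sum-applyUpTo (suc n) f = cong (f 0 +_) (sum-applyUpTo n (f ∘ suc))

∑Range≡∑ : ∀ a k f → ∑Range a k f ≡ ∑[ u < suc k ] f (a + toℕ u)
∑Range≡∑ a k f = trans (cong List.sum (map-applyUpTo id (λ u → f (a + u)) (suc k))) (sum-applyUpTo (suc k) (λ u → f (a + u)))

∑-const : ∀ n c → ∑[ _ < n ] c ≡ n * c
∑-const zero    c = refl
∑-const (suc n) c = cong (c +_) (∑-const n c)

2*∑toℕ+n≡n*n : ∀ n → 2 * ∑[ u < n ] toℕ u + n ≡ n * n
2*∑toℕ+n≡n*n zero    = refl
2*∑toℕ+n≡n*n (suc n) = begin
  2 * ∑[ u < n ] suc (toℕ u) + suc n   ≡⟨ cong (λ z → 2 * z + suc n) ∑suc ⟩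
  2 * (n * 1 + G) + suc n              ≡⟨ regroup n G ⟩
  (2 * G + n) + (2 * n + 1)            ≡⟨ cong (_+ (2 * n + 1)) (2*∑toℕ+n≡n*n n) ⟩
  n * n + (2 * n + 1)                  ≡⟨ square n ⟩
  suc n * suc n                        ∎
  where
  G : ℕ
  G = ∑[ u < n ] toℕ u
  ∑suc : ∑[ u < n ] suc (toℕ u) ≡ n * 1 + G
  ∑suc = trans (∑-distrib-+ {n} (λ _ → 1) toℕ) (cong (_+ G) (∑-const n 1))
  regroup : ∀ n G → 2 * (n * 1 + G) + suc n ≡ (2 * G + n) + (2 * n + 1)
  regroup = solve-∀
  square : ∀ n → n * n + (2 * n + 1) ≡ suc n * suc n
  square = solve-∀

before : ℕ → ℕ → ℕ → ℕ
before zero    u       a = 0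
before (suc s) zero    a = a
before (suc s) (suc u) a = before s u a

before-≥ : ∀ {s u} a → s ≤ u → before s u a ≡ 0
before-≥ {zero}          a _         = refl
before-≥ {suc s} {suc u} a (s≤s s≤u) = before-≥ a s≤u

before-< : ∀ {s u} a → u < s → before s u a ≡ a
before-< {suc s} {zero}  a _         = refl
before-< {suc s} {suc u} a (s≤s u<s) = before-< a u<s

∑-before : ∀ {s N} → s ≤ N → (f : ℕ → ℕ) →
           ∑[ u < N ] before s (toℕ u) (f (toℕ u)) ≡ ∑[ u < s ] f (toℕ u)
∑-before {zero}  {N}     _         f = sum-replicate-zero N
∑-before {suc s} {suc N} (s≤s s≤N) f = cong (f 0 +_) (∑-before s≤N (f ∘ suc))

≤ᵇ-true : ∀ {m n} → m ≤ n → (m ≤ᵇ n) ≡ true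
≤ᵇ-true = dec-true (_ ≤? _)

≤ᵇ-false : ∀ {m n} → ¬ m ≤ n → (m ≤ᵇ n) ≡ false
≤ᵇ-false = dec-false (_ ≤? _)

if-+≤ᵇ≡before : ∀ k s u a → (if k + s ≤ᵇ k + u then 0 else a) ≡ before s u a
if-+≤ᵇ≡before k s u a with s ≤? u
... | yes s≤u rewrite ≤ᵇ-true (+-monoʳ-≤ k s≤u)           = sym (before-≥ a s≤u)
... | no  s≰u rewrite ≤ᵇ-false (s≰u ∘ +-cancelˡ-≤ k s u) = sym (before-< a (≰⇒> s≰u))

DownwardClosed : ∀ {k} → (Fin k → Bool) → Set
DownwardClosed p = ∀ {i j} → i F.≤ j → p j ≡ true → p i ≡ true

increment : ∀ {k} → (Fin (suc k) → ℕ) → Fin k → ℕ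
increment b j = b (F.suc j) ∸ b (inject₁ j)

largestIdx-last-true : ∀ {k} {p : Fin (suc k) → Bool} → p (fromℕ k) ≡ true →
                       largestIdx (suc k) p ≡ fromℕ (suc k)
largestIdx-last-true eq rewrite eq = refl

largestIdx-last-false : ∀ {k} {p : Fin (suc k) → Bool} → p (fromℕ k) ≡ false →
                        largestIdx (suc k) p ≡ inject₁ (largestIdx k (p ∘ inject₁))
largestIdx-last-false eq rewrite eq = refl

b-last≡b-largestIdx+∑increment :
  ∀ k (p : Fin k → Bool) (b : Fin (suc k) → ℕ) → DownwardClosed p →
  (∀ j → b (inject₁ j) ≤ b (F.suc j)) →
  b (fromℕ k) ≡ b (largestIdx k p) + ∑[ j < k ] (if p j then 0 else increment b j)
b-last≡b-largestIdx+∑increment zero    p b closed b-mono = sym (+-identityʳ _)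
b-last≡b-largestIdx+∑increment (suc k) p b closed b-mono = by-last (p (fromℕ k)) refl
  where
  f : Fin (suc k) → ℕ
  f j = if p j then 0 else increment b j
  by-last : ∀ v → p (fromℕ k) ≡ v → b (fromℕ (suc k)) ≡ b (largestIdx (suc k) p) + ∑[ j < suc k ] f j
  by-last true eq = begin
    b (fromℕ (suc k))                        ≡⟨ +-identityʳ _ ⟨
    b (fromℕ (suc k)) + 0                    ≡⟨ cong₂ _+_ (cong b (largestIdx-last-true {p = p} eq)) all-zero ⟨
    b (largestIdx (suc k) p) + ∑[ j < suc k ] f j ∎
    where
    all-zero : ∑[ j < suc k ] f j ≡ 0
    all-zero = trans (sum-cong-≗ λ j → cong (λ c → if c then 0 else increment b j) (closed (≤fromℕ j) eq))
                     (sum-replicate-zero (suc k))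
  by-last false eq = begin
    b (fromℕ (suc k))                        ≡⟨ m+[n∸m]≡n (b-mono (fromℕ k)) ⟨
    b (inject₁ (fromℕ k)) + D                ≡⟨ cong (_+ D) IH ⟩
    b (inject₁ ℓ) + Σ′ + D                   ≡⟨ +-assoc _ Σ′ D ⟩
    b (inject₁ ℓ) + (Σ′ + D)                 ≡⟨ cong₂ _+_ (cong b (largestIdx-last-false {p = p} eq))
                                                          (cong (λ c → Σ′ + (if c then 0 else D)) eq) ⟨
    b (largestIdx (suc k) p) + (Σ′ + f (fromℕ k)) ≡⟨ cong (b (largestIdx (suc k) p) +_) (sum-init-last f) ⟨
    b (largestIdx (suc k) p) + ∑[ j < suc k ] f j ∎
    where
    D Σ′ : ℕ
    D = increment b (fromℕ k)
    Σ′ = ∑[ j < k ] f (inject₁ j)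
    ℓ : Fin (suc k)
    ℓ = largestIdx k (p ∘ inject₁)
    closed′ : DownwardClosed (p ∘ inject₁)
    closed′ {i} {j} i≤j = closed (subst₂ _≤_ (sym (toℕ-inject₁ i)) (sym (toℕ-inject₁ j)) i≤j)
    IH : b (inject₁ (fromℕ k)) ≡ b (inject₁ ℓ) + Σ′
    IH = b-last≡b-largestIdx+∑increment k (p ∘ inject₁) (b ∘ inject₁) closed′ (b-mono ∘ inject₁)

m∸n+[n∸o]≡m∸o : ∀ {m n o} → o ≤ n → n ≤ m → (m ∸ n) + (n ∸ o) ≡ m ∸ o
m∸n+[n∸o]≡m∸o {m} {n} {o} o≤n n≤m = begin
  (m ∸ n) + (n ∸ o)   ≡⟨ +-∸-assoc (m ∸ n) o≤n ⟨
  (m ∸ n) + n ∸ o     ≡⟨ cong (_∸ o) (m∸n+n≡m n≤m) ⟩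
  m ∸ o               ∎

2*m∸1∸2*n+1≡2*[m∸n] : ∀ {m n} → n < m → 2 * m ∸ 1 ∸ 2 * n + 1 ≡ 2 * (m ∸ n)
2*m∸1∸2*n+1≡2*[m∸n] {m} {n} n<m = begin
  2 * m ∸ 1 ∸ 2 * n + 1     ≡⟨ cong (_+ 1) (∸-+-assoc (2 * m) 1 (2 * n)) ⟩
  2 * m ∸ (1 + 2 * n) + 1   ≡⟨ cong (λ z → 2 * m ∸ z + 1) (+-comm 1 (2 * n)) ⟩
  2 * m ∸ (2 * n + 1) + 1   ≡⟨ cong (_+ 1) (∸-+-assoc (2 * m) (2 * n) 1) ⟨
  2 * m ∸ 2 * n ∸ 1 + 1     ≡⟨ cong (λ z → z ∸ 1 + 1) (*-distribˡ-∸ 2 m n) ⟨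
  2 * (m ∸ n) ∸ 1 + 1       ≡⟨ m∸n+n≡m (≤-trans (n≤1+n 1) (*-monoʳ-≤ 2 (m<n⇒0<n∸m n<m))) ⟩
  2 * (m ∸ n)               ∎

-- One chain: b j = b(Mʲ) and x j is the slot of Mʲ⁺¹, so T₀ + s j = S(Mʲ⁺¹); for chain i
-- of an instance, age and weight unfold to AgeSchedule.age i and the weights of corresponding.
module Chain {T₀ T m : ℕ} (b : Fin (suc m) → ℕ) (x : Fin m → Fin T) where

  s : Fin m → ℕ
  s j = suc (toℕ (x j))

  latest : ℕ → Fin (suc m)
  latest t = largestIdx m (λ j → T₀ + s j ≤ᵇ t)

  age : ℕ → ℕ
  age t = if does (latest t F.≟ fromℕ m) then 0 else t ∸ b (latest t)

  weight : Fin m → ℕ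
  weight j = if suc (toℕ j) ≡ᵇ m then 2 * T₀ ∸ 1 ∸ 2 * b (inject₁ j) else 2 * increment b j

module NonemptyChain {T₀ T k : ℕ} (b : Fin (suc (suc k)) → ℕ) (x : Fin (suc k) → Fin T)
  (b-inc : ∀ i j → i F.< j → b i < b j) (b-last≤T₀ : b (fromℕ (suc k)) ≤ T₀)
  (x-inc : ∀ i j → i F.< j → x i F.< x j) where

  open Chain {T₀} b x

  L : Fin (suc k)
  L = fromℕ k

  B c : ℕ
  B = b (fromℕ (suc k))
  c = T₀ ∸ B

  s-mono : ∀ {i j} → i F.≤ j → s i ≤ s j
  s-mono {i} {j} i≤j with m≤n⇒m<n∨m≡n i≤j
  ... | inj₁ i<j = s≤s (<⇒≤ (x-inc i j i<j))
  ... | inj₂ i≡j = ≤-reflexive (cong s (toℕ-injective i≡j))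

  s≤1+T : ∀ j → s j ≤ suc T
  s≤1+T j = s≤s (<⇒≤ (toℕ<n (x j)))

  b-step : ∀ j → b (inject₁ j) < b (F.suc j)
  b-step j = b-inc (inject₁ j) (F.suc j) (≤̄⇒inject₁< ≤-refl)

  delivered-closed : ∀ t → DownwardClosed (λ j → T₀ + s j ≤ᵇ t)
  delivered-closed t i≤j eq = ≤ᵇ-true (≤-trans (+-monoʳ-≤ T₀ (s-mono i≤j)) (≤ᵇ⇒≤ _ t (Equivalence.from T-≡ eq)))

  pending : ℕ → ℕ
  pending u = ∑[ j < suc k ] before (s j) u (increment b j)

  B≡b-latest+pending : ∀ u → B ≡ b (latest (T₀ + u)) + pending u
  B≡b-latest+pending u = trans
    (b-last≡b-largestIdx+∑increment (suc k) _ b (delivered-closed (T₀ + u)) (<⇒≤ ∘ b-step))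
    (cong (b (latest (T₀ + u)) +_) (sum-cong-≗ λ j → if-+≤ᵇ≡before T₀ (s j) u (increment b j)))

  age≡ : ∀ u → age (T₀ + u) ≡ before (s L) u (u + c) + pending u
  age≡ u with s L ≤? u
  ... | yes sL≤u = begin
      age (T₀ + u)                        ≡⟨ cong (λ d → if d then 0 else T₀ + u ∸ b ℓ)
                                                  (dec-true (ℓ F.≟ fromℕ (suc k)) all-delivered) ⟩
      0                                   ≡⟨ cong₂ _+_ (before-≥ (u + c) sL≤u) nothing-pending ⟨
      before (s L) u (u + c) + pending u  ∎
    where
    ℓ : Fin (suc (suc k))
    ℓ = latest (T₀ + u)
    all-delivered : ℓ ≡ fromℕ (suc k)
    all-delivered = largestIdx-last-true {p = λ j → T₀ + s j ≤ᵇ T₀ + u} (≤ᵇ-true (+-monoʳ-≤ T₀ sL≤u))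
    nothing-pending : pending u ≡ 0
    nothing-pending = +-cancelˡ-≡ B _ _ (begin
      B + pending u    ≡⟨ cong (λ l → b l + pending u) all-delivered ⟨
      b ℓ + pending u  ≡⟨ B≡b-latest+pending u ⟨
      B                ≡⟨ +-identityʳ B ⟨
      B + 0            ∎)
  ... | no sL≰u = begin
      age (T₀ + u)                         ≡⟨ cong (λ d → if d then 0 else T₀ + u ∸ b ℓ)
                                                   (dec-false (ℓ F.≟ fromℕ (suc k)) undelivered) ⟩
      T₀ + u ∸ b ℓ                         ≡⟨ cong (_∸ b ℓ) split ⟩
      u + c + pending u + b ℓ ∸ b ℓ        ≡⟨ m+n∸n≡m _ (b ℓ) ⟩
      u + c + pending u                    ≡⟨ cong (_+ pending u) (before-< (u + c) (≰⇒> sL≰u)) ⟨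
      before (s L) u (u + c) + pending u   ∎
    where
    ℓ : Fin (suc (suc k))
    ℓ = latest (T₀ + u)
    undelivered : ℓ ≢ fromℕ (suc k)
    undelivered ℓ≡last = fromℕ≢inject₁ (trans (sym ℓ≡last)
      (largestIdx-last-false {p = λ j → T₀ + s j ≤ᵇ T₀ + u} (≤ᵇ-false (sL≰u ∘ +-cancelˡ-≤ T₀ _ _))))
    regroup : ∀ c l p u → c + (l + p) + u ≡ u + c + p + l
    regroup = solve-∀
    split : T₀ + u ≡ u + c + pending u + b ℓ
    split = begin
      T₀ + u                    ≡⟨ cong (_+ u) (m∸n+n≡m b-last≤T₀) ⟨
      c + B + u                 ≡⟨ cong (λ z → c + z + u) (B≡b-latest+pending u) ⟩
      c + (b ℓ + pending u) + u ≡⟨ regroup c (b ℓ) (pending u) u ⟩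
      u + c + pending u + b ℓ   ∎

  ∑age : ∑[ u < suc T ] age (T₀ + toℕ u) ≡ (∑[ u < s L ] toℕ u + s L * c) + ∑[ j < suc k ] (s j * increment b j)
  ∑age = begin
    ∑[ u < suc T ] age (T₀ + toℕ u)
      ≡⟨ sum-cong-≗ {suc T} (age≡ ∘ toℕ) ⟩
    ∑[ u < suc T ] (before (s L) (toℕ u) (toℕ u + c) + pending (toℕ u))
      ≡⟨ ∑-distrib-+ {suc T} (λ u → before (s L) (toℕ u) (toℕ u + c)) (pending ∘ toℕ) ⟩
    ∑[ u < suc T ] before (s L) (toℕ u) (toℕ u + c) + ∑[ u < suc T ] pending (toℕ u)
      ≡⟨ cong₂ _+_ (∑-before (s≤1+T L) (_+ c)) (∑-comm {suc T} {suc k} λ u j → before (s j) (toℕ u) (increment b j)) ⟩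
    ∑[ u < s L ] (toℕ u + c) + ∑[ j < suc k ] ∑[ u < suc T ] before (s j) (toℕ u) (increment b j)
      ≡⟨ cong₂ _+_ (trans (∑-distrib-+ {s L} toℕ (λ _ → c)) (cong (∑[ u < s L ] toℕ u +_) (∑-const (s L) c)))
                   (sum-cong-≗ {suc k} λ j → trans (∑-before (s≤1+T j) (λ _ → increment b j)) (∑-const (s j) _)) ⟩
    (∑[ u < s L ] toℕ u + s L * c) + ∑[ j < suc k ] (s j * increment b j)  ∎

  weight-inject₁ : ∀ j → weight (inject₁ j) ≡ 2 * increment b (inject₁ j)
  weight-inject₁ j = cong (λ d → if d then 2 * T₀ ∸ 1 ∸ 2 * b (inject₁ (inject₁ j)) else 2 * increment b (inject₁ j))
                          (dec-false (toℕ (inject₁ j) ≟ k) (toℕ-inject₁-≢ j ∘ sym))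

  weight-last+1 : weight L + 1 ≡ 2 * (c + increment b L)
  weight-last+1 = begin
    weight L + 1                        ≡⟨ cong (λ d → (if d then 2 * T₀ ∸ 1 ∸ 2 * b (inject₁ L) else 2 * increment b L) + 1)
                                                (dec-true (toℕ L ≟ k) (toℕ-fromℕ k)) ⟩
    2 * T₀ ∸ 1 ∸ 2 * b (inject₁ L) + 1  ≡⟨ 2*m∸1∸2*n+1≡2*[m∸n] (<-≤-trans (b-step L) b-last≤T₀) ⟩
    2 * (T₀ ∸ b (inject₁ L))            ≡⟨ cong (2 *_) (m∸n+[n∸o]≡m∸o (<⇒≤ (b-step L)) b-last≤T₀) ⟨
    2 * (c + increment b L)             ∎

  ∑weight+s-last : ∑[ j < suc k ] (weight j * s j) + s L ≡ 2 * ∑[ j < suc k ] (s j * increment b j) + 2 * (s L * c)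
  ∑weight+s-last = begin
    ∑[ j < suc k ] (weight j * s j) + s L
      ≡⟨ cong (_+ s L) (sum-init-last (λ j → weight j * s j)) ⟩
    ∑[ j < k ] (weight (inject₁ j) * s (inject₁ j)) + weight L * s L + s L
      ≡⟨ cong (λ z → z + weight L * s L + s L) ∑weight-init ⟩
    2 * Σ′ + weight L * s L + s L
      ≡⟨ factor (2 * Σ′) (weight L) (s L) ⟩
    2 * Σ′ + (weight L + 1) * s L
      ≡⟨ cong (λ z → 2 * Σ′ + z * s L) weight-last+1 ⟩
    2 * Σ′ + 2 * (c + increment b L) * s L
      ≡⟨ regroup Σ′ (s L) c (increment b L) ⟩
    2 * (Σ′ + s L * increment b L) + 2 * (s L * c)
      ≡⟨ cong (λ z → 2 * z + 2 * (s L * c)) (sum-init-last (λ j → s j * increment b j)) ⟨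
    2 * ∑[ j < suc k ] (s j * increment b j) + 2 * (s L * c) ∎
    where
    Σ′ : ℕ
    Σ′ = ∑[ j < k ] (s (inject₁ j) * increment b (inject₁ j))
    regroup : ∀ Σ s c d → 2 * Σ + 2 * (c + d) * s ≡ 2 * (Σ + s * d) + 2 * (s * c)
    regroup = solve-∀
    factor : ∀ a w s → a + w * s + s ≡ a + (w + 1) * s
    factor = solve-∀
    swap : ∀ d s → 2 * d * s ≡ 2 * (s * d)
    swap = solve-∀
    ∑weight-init : ∑[ j < k ] (weight (inject₁ j) * s (inject₁ j)) ≡ 2 * Σ′
    ∑weight-init = begin
      ∑[ j < k ] (weight (inject₁ j) * s (inject₁ j))
        ≡⟨ sum-cong-≗ {k} (λ j → trans (cong (_* s (inject₁ j)) (weight-inject₁ j)) (swap (increment b (inject₁ j)) (s (inject₁ j)))) ⟩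
      ∑[ j < k ] (2 * (s (inject₁ j) * increment b (inject₁ j)))
        ≡⟨ *-distribˡ-sum 2 (λ j → s (inject₁ j) * increment b (inject₁ j)) ⟨
      2 * Σ′ ∎

  2*∑age≡∑weight+s-last² : 2 * ∑Range T₀ T age ≡ ∑Fin (suc k) (λ j → weight j * s j) + s L * s L
  -- Adding s L to both sides avoids the truncated −1 of the last weight and of 2 Σ_{u<s} u = s² − s.
  2*∑age≡∑weight+s-last² = +-cancelʳ-≡ (s L) _ _ (begin
    2 * ∑Range T₀ T age + s L                         ≡⟨ cong (λ z → 2 * z + s L) (trans (∑Range≡∑ T₀ T age) ∑age) ⟩
    2 * ((G + s L * c) + D) + s L                     ≡⟨ regroup G (s L) c D ⟩
    (2 * G + s L) + (2 * D + 2 * (s L * c))           ≡⟨ cong₂ _+_ (2*∑toℕ+n≡n*n (s L)) (sym ∑weight+s-last) ⟩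
    s L * s L + (W + s L)                             ≡⟨ regroup′ (s L * s L) W (s L) ⟩
    W + s L * s L + s L                               ≡⟨ cong (λ z → z + s L * s L + s L) (∑Fin≡∑ (suc k) (λ j → weight j * s j)) ⟨
    ∑Fin (suc k) (λ j → weight j * s j) + s L * s L + s L ∎)
    where
    G D W : ℕ
    G = ∑[ u < s L ] toℕ u
    D = ∑[ j < suc k ] (s j * increment b j)
    W = ∑[ j < suc k ] (weight j * s j)
    regroup : ∀ G s c D → 2 * ((G + s * c) + D) + s ≡ (2 * G + s) + (2 * D + 2 * (s * c))
    regroup = solve-∀
    regroup′ : ∀ q W s → q + (W + s) ≡ W + q + s
    regroup′ = solve-∀

2*∑age≡∑weight+s-last² :
  ∀ {T₀ T m} (m-pos : 0 < m) (b : Fin (suc m) → ℕ) (x : Fin m → Fin T) →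
  (∀ i j → i F.< j → b i < b j) → b (fromℕ m) ≤ T₀ → (∀ i j → i F.< j → x i F.< x j) →
  let open Chain {T₀} b x in
  2 * ∑Range T₀ T age ≡ ∑Fin m (λ j → weight j * s j) + s (lastOf m m-pos) * s (lastOf m m-pos)
2*∑age≡∑weight+s-last² {m = suc k} _ b x b-inc b-last≤T₀ x-inc =
  NonemptyChain.2*∑age≡∑weight+s-last² b x b-inc b-last≤T₀ x-inc

module _ (I : AgeInstance) where
  open AgeInstance I

  asJobSchedule : AgeSchedule I → JobSchedule (corresponding I)
  asJobSchedule Sa = record { slot = AgeSchedule.slot Sa ; chain = AgeSchedule.chain Sa }

  asAgeSchedule : JobSchedule (corresponding I) → AgeSchedule I
  asAgeSchedule Sj = record { slot = JobSchedule.slot Sj ; chain = JobSchedule.chain Sj }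

  2*Age≡wcs : (Sa : AgeSchedule I) → 2 * AgeSchedule.Age Sa ≡ JobSchedule.wcs (asJobSchedule Sa)
  2*Age≡wcs Sa = begin
    2 * ∑Fin n A                      ≡⟨ cong (2 *_) (∑Fin≡∑ n A) ⟩
    2 * ∑[ i < n ] A i                ≡⟨ *-distribˡ-sum 2 A ⟩
    ∑[ i < n ] (2 * A i)              ≡⟨ sum-cong-≗ {n} per-chain ⟩
    ∑[ i < n ] (X i + Y i)            ≡⟨ ∑-distrib-+ X Y ⟩
    ∑[ i < n ] X i + ∑[ i < n ] Y i   ≡⟨ cong₂ _+_ (∑Fin≡∑ n X) (∑Fin≡∑ n Y) ⟨
    ∑Fin n X + ∑Fin n Y               ∎
    where
    open AgeSchedule Sa using (slot; chain; age)
    open JobSchedule (asJobSchedule Sa) using (S)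
    A X Y : Fin n → ℕ
    A i = ∑Range T₀ (Ttot I) (age i)
    X i = ∑Fin (m i) (λ j → WCSInstance.w (corresponding I) i j * S (i , j))
    Y i = S (i , lastOf (m i) (m-pos i)) * S (i , lastOf (m i) (m-pos i))
    per-chain : ∀ i → 2 * A i ≡ X i + Y i
    per-chain i = 2*∑age≡∑weight+s-last² (m-pos i) (b i) (λ j → Bijection.to slot (i , j)) (b-inc i) (b-le i) (chain i)

lemma2 : (I : AgeInstance) (Sa : AgeSchedule I) (Sj : JobSchedule (corresponding I)) →
         AgeOptimal I Sa → WCSOptimal (corresponding I) Sj →
         2 * AgeSchedule.Age Sa ≡ JobSchedule.wcs Sj
lemma2 I Sa Sj Sa-optimal Sj-optimal = ≤-antisym
  (≤-trans (*-monoʳ-≤ 2 (Sa-optimal (asAgeSchedule I Sj))) (≤-reflexive (2*Age≡wcs I (asAgeSchedule I Sj))))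
  (≤-trans (Sj-optimal (asJobSchedule I Sa)) (≤-reflexive (sym (2*Age≡wcs I Sa))))
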